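{- If a finite simple graph $G$ is positive, then for each odd integer $k$, the number of vertices of $G$ of degree $k$ is even.
   Context: A simple graph $G$ is positive if $\hom(G,H)=\sum_{\varphi:V(G)\to V(H)}\prod_{uv\in E(G)}\beta_{\varphi(u)\varphi(v)}\ge0$ for every graph $H$ with real (possibly negative) symmetric edge weights $\beta$, loops allowed. -}

module Defs where

open import Data.Nat using (ℕ; zero; suc; _*_; _+_)
open import Data.Fin using (Fin; zero; suc; toℕ)
open import Data.Fin.Properties using (_<?_)
open import Data.Bool using (Bool; true; false; if_then_else_)
open import Data.List using (List; []; _∷_; map; concatMap; allFin; filter; length; foldr)
open import Data.Product using (∃)
open import Data.Rational using (ℚ; 0ℚ; 1ℚ; _≤_) renaming (_+_ to _+ℚ_; _*_ to _*ℚ_)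
open import Relation.Binary.PropositionalEquality using (_≡_)
open import Relation.Nullary.Decidable using (⌊_⌋)

record SimpleGraph (n : ℕ) : Set where
  field
    adj   : Fin n → Fin n → Bool
    sym   : ∀ u v → adj u v ≡ adj v u
    loopless : ∀ v → adj v v ≡ false
open SimpleGraph public

-- A weighted graph H on Fin m with symmetric rational edge weights (loops allowed,
-- weight β i i on the loop at i; weight 0 means "no edge").
record WeightedGraph (m : ℕ) : Set where
  field
    β      : Fin m → Fin m → ℚ
    β-sym  : ∀ i j → β i j ≡ β j i
open WeightedGraph public

extend : ∀ {n m} → Fin m → (Fin n → Fin m) → Fin (suc n) → Fin m
extend j f zero    = j
extend j f (suc i) = f i

allMaps : (n m : ℕ) → List (Fin n → Fin m)
allMaps zero    m = (λ ()) ∷ []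
allMaps (suc n) m = concatMap (λ f → map (λ j → extend j f) (allFin m)) (allMaps n m)

sumℚ : List ℚ → ℚ
sumℚ = foldr _+ℚ_ 0ℚ

prodℚ : List ℚ → ℚ
prodℚ = foldr _*ℚ_ 1ℚ

edgeProduct : ∀ {n m} → SimpleGraph n → WeightedGraph m → (Fin n → Fin m) → ℚ
edgeProduct {n} G H φ =
  prodℚ (concatMap (λ u → map (λ v →
      if adj G u v ∧' ⌊ toℕ u Data.Nat.<? toℕ v ⌋
      then β H (φ u) (φ v) else 1ℚ) (allFin n)) (allFin n))
  where
  open import Data.Nat using (_<?_)
  _∧'_ : Bool → Bool → Bool
  true ∧' b = b
  false ∧' b = false

hom : ∀ {n m} → SimpleGraph n → WeightedGraph m → ℚ
hom {n} {m} G H = sumℚ (map (edgeProduct G H) (allMaps n m))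

Positive : ∀ {n} → SimpleGraph n → Set
Positive G = ∀ (m : ℕ) (H : WeightedGraph m) → 0ℚ ≤ hom G H

degree : ∀ {n} → SimpleGraph n → Fin n → ℕ
degree {n} G u = length (filter (λ v → adj G u v Data.Bool.≟ true) (allFin n))
  where import Data.Bool

countDegree : ∀ {n} → SimpleGraph n → ℕ → ℕ
countDegree {n} G k = length (filter (λ u → degree G u Data.Nat.≟ k) (allFin n))
  where import Data.Nat

Odd : ℕ → Set
Odd k = ∃ λ j → k ≡ suc (2 * j)

Even : ℕ → Set
Even k = ∃ λ j → k ≡ 2 * j

module Submission where

-- Idea: test positivity against a rank-one weighted graph, β i j = w i · w j.
-- Every homomorphism φ then has weight Π_u w(φ u)^deg(u), so summing over φ
-- factorises:  hom(G, H) = Π_u p(deg u)  with the power sum p(d) = Σ_i (w i)^d.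
-- If the weights make p(d) negative for d = k and positive for every other d,
-- the sign of hom(G, H) is (−1)^(number of vertices of degree k); positivity
-- forces that number to be even.  For k = 2j+1 such weights exist:
-- N = 2^(4j+1) weights 1, L = 2^(2j+2) weights −2 and a single weight 4 give
-- p(d) = N + L(−2)^d + 4^d, which is positive at even d and, at odd d, negative
-- exactly when L·2^d exceeds N + 4^d, i.e. exactly when d = k.

open import Algebra.Bundles using (CommutativeMonoid; CommutativeSemiring; CommutativeRing)
open import Data.Bool using (Bool; true; false; if_then_else_; _∧_; _∨_)
import Data.Bool as Bool
open import Data.Empty using (⊥-elim)
open import Data.Fin using (Fin; toℕ) renaming (zero to fzero; suc to fsuc)
open import Data.Fin.Properties using (toℕ-injective)
open import Data.List using (List; []; _∷_; _++_; map; concatMap; foldr; filter; length; replicate; allFin; tabulate; lookup)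
open import Data.List.Properties using (map-tabulate; map-concatMap; map-∘; map-cong; concatMap-cong; map-++; tabulate-lookup)
open import Data.Nat as ℕ using (ℕ; zero; suc; _<?_)
import Data.Nat.Properties as ℕₚ
open import Data.Product using (_×_; _,_; ∃; proj₁; proj₂)
open import Data.Rational using (ℚ; 0ℚ; 1ℚ; -_; _-_; _<_; _≤_; positive; negative) renaming (_+_ to _+ℚ_; _*_ to _*ℚ_)
import Data.Rational.Properties as ℚ
open import Data.Rational.Solver using (module +-*-Solver)
open import Data.Sum using (_⊎_; inj₁; inj₂)
open import Function using (_∘_)
open import Relation.Binary.Definitions using (tri<; tri≈; tri>)
import Relation.Binary.PropositionalEquality as ≡
open ≡ using (_≡_; _≢_)
open import Relation.Nullary using (¬_; yes; no)
open import Relation.Nullary.Decidable using (⌊_⌋)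
open import Relation.Unary using (Decidable)

open import Defs hiding (sym)

module Fold {c ℓ} (M : CommutativeMonoid c ℓ) where
  open CommutativeMonoid M
  open import Algebra.Definitions.RawMonoid rawMonoid public using () renaming (_×_ to _times_)
  open import Algebra.Properties.CommutativeSemigroup commutativeSemigroup using (interchange)
  open import Relation.Binary.Reasoning.Setoid setoid

  fold : List Carrier → Carrier
  fold = foldr _∙_ ε

  fold-++ : ∀ xs ys → fold (xs ++ ys) ≈ fold xs ∙ fold ys
  fold-++ []       ys = sym (identityˡ _)
  fold-++ (x ∷ xs) ys = trans (∙-congˡ (fold-++ xs ys)) (sym (assoc x _ _))

  fold-concatMap : ∀ {a} {A : Set a} (f : A → List Carrier) xs →
                   fold (concatMap f xs) ≈ fold (map (fold ∘ f) xs)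
  fold-concatMap f []       = refl
  fold-concatMap f (x ∷ xs) = trans (fold-++ (f x) _) (∙-congˡ (fold-concatMap f xs))

  fold-cong : ∀ {a} {A : Set a} {f g : A → Carrier} → (∀ x → f x ≈ g x) →
              ∀ xs → fold (map f xs) ≈ fold (map g xs)
  fold-cong f≈g []       = refl
  fold-cong f≈g (x ∷ xs) = ∙-cong (f≈g x) (fold-cong f≈g xs)

  fold-ε : ∀ {a} {A : Set a} (xs : List A) → fold (map (λ _ → ε) xs) ≈ ε
  fold-ε []       = refl
  fold-ε (x ∷ xs) = trans (identityˡ _) (fold-ε xs)

  fold-∙ : ∀ {a} {A : Set a} (f g : A → Carrier) xs →
           fold (map (λ x → f x ∙ g x) xs) ≈ fold (map f xs) ∙ fold (map g xs)
  fold-∙ f g []       = sym (identityˡ ε)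
  fold-∙ f g (x ∷ xs) = trans (∙-congˡ (fold-∙ f g xs)) (interchange (f x) (g x) _ _)

  fold-swap : ∀ {a b} {A : Set a} {B : Set b} (f : A → B → Carrier) xs ys →
              fold (map (λ x → fold (map (f x) ys)) xs) ≈ fold (map (λ y → fold (map (λ x → f x y) xs)) ys)
  fold-swap f []       ys = sym (fold-ε ys)
  fold-swap f (x ∷ xs) ys = trans (∙-congˡ (fold-swap f xs ys))
                                  (sym (fold-∙ (f x) (λ y → fold (map (λ x → f x y) xs)) ys))

  fold-indicator : ∀ {a} {A : Set a} (b : A → Bool) (x : Carrier) xs →
                   fold (map (λ y → if b y then x else ε) xs) ≈ length (filter (λ y → b y Bool.≟ true) xs) times x
  fold-indicator b x []       = refl
  fold-indicator b x (y ∷ xs) with b y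
  ... | true  = ∙-congˡ (fold-indicator b x xs)
  ... | false = trans (identityˡ _) (fold-indicator b x xs)

  indicator-merge : ∀ b c x → b ∧ c ≡ false →
                    (if b then x else ε) ∙ (if c then x else ε) ≈ (if b ∨ c then x else ε)
  indicator-merge true  false x _ = identityʳ x
  indicator-merge false true  x _ = identityˡ x
  indicator-merge false false x _ = identityˡ ε

  indicator-∙ : ∀ b x y → (if b then x ∙ y else ε) ≈ (if b then x else ε) ∙ (if b then y else ε)
  indicator-∙ true  x y = refl
  indicator-∙ false x y = sym (identityˡ ε)

  Orients : ∀ {a} {A : Set a} → (s r : A → A → Bool) → Set a
  Orients s r = ∀ u v → (s u v ∨ s v u ≡ r u v) × (s u v ∧ s v u ≡ false)

  fold-oriented-pairs : ∀ {a} {A : Set a} {s r : A → A → Bool} → Orients s r → ∀ (x : A → Carrier) xs →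
    fold (concatMap (λ u → map (λ v → if s u v then x u ∙ x v else ε) xs) xs)
      ≈ fold (map (λ u → length (filter (λ v → r u v Bool.≟ true) xs) times x u) xs)
  fold-oriented-pairs {A = A} {s} {r} orient x xs = begin
    fold (concatMap (λ u → map (λ v → if s u v then x u ∙ x v else ε) xs) xs)
      ≈⟨ fold-concatMap _ xs ⟩
    fold (map (λ u → fold (map (λ v → if s u v then x u ∙ x v else ε) xs)) xs)
      ≈⟨ fold-cong (λ u → trans (fold-cong (λ v → indicator-∙ (s u v) (x u) (x v)) xs)
                                (fold-∙ (out u) (into u) xs)) xs ⟩
    fold (map (λ u → fold (map (out u) xs) ∙ fold (map (into u) xs)) xs)
      ≈⟨ fold-∙ (λ u → fold (map (out u) xs)) (λ u → fold (map (into u) xs)) xs ⟩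
    fold (map (λ u → fold (map (out u) xs)) xs) ∙ fold (map (λ u → fold (map (into u) xs)) xs)
      ≈⟨ ∙-congˡ (fold-swap into xs xs) ⟩
    fold (map (λ u → fold (map (out u) xs)) xs) ∙ fold (map (λ u → fold (map (λ v → into v u) xs)) xs)
      ≈⟨ sym (fold-∙ (λ u → fold (map (out u) xs)) (λ u → fold (map (λ v → into v u) xs)) xs) ⟩
    fold (map (λ u → fold (map (out u) xs) ∙ fold (map (λ v → into v u) xs)) xs)
      ≈⟨ fold-cong (λ u → trans (sym (fold-∙ (out u) (λ v → into v u) xs)) (fold-cong (merge u) xs)) xs ⟩
    fold (map (λ u → fold (map (λ v → if r u v then x u else ε) xs)) xs)
      ≈⟨ fold-cong (λ u → fold-indicator (r u) (x u) xs) xs ⟩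
    fold (map (λ u → length (filter (λ v → r u v Bool.≟ true) xs) times x u) xs) ∎
    where
    out into : A → A → Carrier
    out  u v = if s u v then x u else ε
    into u v = if s u v then x v else ε
    merge : ∀ u v → out u v ∙ into v u ≈ (if r u v then x u else ε)
    merge u v with orient u v
    ... | covers , disjoint = trans (indicator-merge (s u v) (s v u) (x u) disjoint)
                                    (reflexive (≡.cong (λ b → if b then x u else ε) covers))

map-allFin-suc : ∀ {a} {A : Set a} n (f : Fin (suc n) → A) →
                 map f (allFin (suc n)) ≡ f fzero ∷ map (f ∘ fsuc) (allFin n)
map-allFin-suc n f = ≡.cong (f fzero ∷_) (≡.trans (map-tabulate fsuc f) (≡.sym (map-tabulate (λ i → i) (f ∘ fsuc))))

module BigOperators {c ℓ} (R : CommutativeSemiring c ℓ) where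
  open CommutativeSemiring R
  open import Relation.Binary.Reasoning.Setoid setoid
  module Σ = Fold +-commutativeMonoid
  module Π = Fold *-commutativeMonoid

  sum prod : List Carrier → Carrier
  sum  = Σ.fold
  prod = Π.fold

  sum-*ˡ : ∀ {a} {A : Set a} x (f : A → Carrier) xs → sum (map (λ y → x * f y) xs) ≈ x * sum (map f xs)
  sum-*ˡ x f []       = sym (zeroʳ x)
  sum-*ˡ x f (y ∷ xs) = trans (+-congˡ (sum-*ˡ x f xs)) (sym (distribˡ x (f y) _))

  sum-*ʳ : ∀ {a} {A : Set a} x (f : A → Carrier) xs → sum (map (λ y → f y * x) xs) ≈ sum (map f xs) * x
  sum-*ʳ x f []       = sym (zeroˡ x)
  sum-*ʳ x f (y ∷ xs) = trans (+-congˡ (sum-*ʳ x f xs)) (sym (distribʳ x (f y) _))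

  sum-of-products : ∀ n m (F : Fin n → Fin m → Carrier) →
    sum (map (λ φ → prod (map (λ u → F u (φ u)) (allFin n))) (allMaps n m))
      ≈ prod (map (λ u → sum (map (F u) (allFin m))) (allFin n))
  sum-of-products zero    m F = +-identityʳ 1#
  sum-of-products (suc n) m F = begin
    sum (map term (concatMap (λ φ → map (λ i → extend i φ) (allFin m)) (allMaps n m)))
      ≡⟨ ≡.cong sum (map-concatMap term (λ φ → map (λ i → extend i φ) (allFin m)) (allMaps n m)) ⟩
    sum (concatMap (λ φ → map term (map (λ i → extend i φ) (allFin m))) (allMaps n m))
      ≈⟨ Σ.fold-concatMap _ (allMaps n m) ⟩
    sum (map (λ φ → sum (map term (map (λ i → extend i φ) (allFin m)))) (allMaps n m))
      ≈⟨ Σ.fold-cong extensions (allMaps n m) ⟩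
    sum (map (λ φ → first * rest φ) (allMaps n m))
      ≈⟨ sum-*ˡ first rest (allMaps n m) ⟩
    first * sum (map rest (allMaps n m))
      ≈⟨ *-congˡ (sum-of-products n m (F ∘ fsuc)) ⟩
    first * prod (map (λ u → sum (map (F (fsuc u)) (allFin m))) (allFin n))
      ≡⟨ ≡.cong prod (map-allFin-suc n (λ u → sum (map (F u) (allFin m)))) ⟨
    prod (map (λ u → sum (map (F u) (allFin m))) (allFin (suc n))) ∎
    where
    term : (Fin (suc n) → Fin m) → Carrier
    term φ = prod (map (λ u → F u (φ u)) (allFin (suc n)))
    first : Carrier
    first = sum (map (F fzero) (allFin m))
    rest : (Fin n → Fin m) → Carrier
    rest φ = prod (map (λ u → F (fsuc u) (φ u)) (allFin n))
    extensions : ∀ φ → sum (map term (map (λ i → extend i φ) (allFin m))) ≈ first * rest φ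
    extensions φ = begin
      sum (map term (map (λ i → extend i φ) (allFin m)))
        ≡⟨ ≡.cong sum (map-∘ (allFin m)) ⟨
      sum (map (λ i → term (extend i φ)) (allFin m))
        ≡⟨ ≡.cong sum (map-cong (λ i → ≡.cong prod (map-allFin-suc n (λ u → F u (extend i φ u)))) (allFin m)) ⟩
      sum (map (λ i → F fzero i * rest φ) (allFin m))
        ≈⟨ sum-*ʳ (rest φ) (F fzero) (allFin m) ⟩
      first * rest φ ∎

module PowerGaps where
  open import Data.Nat using (_+_; _*_; _^_)
  open import Data.Nat.Properties
  open import Data.Nat.Tactic.RingSolver using (solve-∀)
  open ≡ using (refl; cong; sym; trans)

  -- multiplicities of the weights 1 and −2 used to detect the odd degree 2j+1
  copies₁ copies₋₂ : ℕ → ℕ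
  copies₁  j = 2 ^ suc (4 * j)
  copies₋₂ j = 2 ^ (2 + 2 * j)

  negative-part : ∀ j d → copies₋₂ j * 2 ^ d ≡ 2 ^ (2 + 2 * j + d)
  negative-part j d = sym (^-distribˡ-+-* 2 (2 + 2 * j) d)

  four^ : ∀ d → 4 ^ d ≡ 2 ^ (2 * d)
  four^ d = ^-*-assoc 2 2 d

  -- For an odd degree d = 2e+1 below 2j+1, N alone outweighs L·2^d.
  below-gap : ∀ j e r → j ≡ suc (e + r) → copies₋₂ j * 2 ^ suc (2 * e) ℕ.< copies₁ j + 4 ^ suc (2 * e)
  below-gap j e r refl = begin-strict
    copies₋₂ j * 2 ^ d    ≡⟨ negative-part j d ⟩
    2 ^ (2 + 2 * j + d)   ≤⟨ ^-monoʳ-≤ 2 (m+n≤o⇒m≤o (2 + 2 * j + d) (≤-reflexive (exponents e r))) ⟩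
    copies₁ j             <⟨ m<m+n (copies₁ j) (m^n>0 4 d) ⟩
    copies₁ j + 4 ^ d     ∎
    where
    open ≤-Reasoning
    d = suc (2 * e)
    exponents : ∀ e r → 2 + 2 * suc (e + r) + suc (2 * e) + 2 * r ≡ suc (4 * suc (e + r))
    exponents = solve-∀

  -- For an odd degree d = 2e+1 above 2j+1, 4^d alone outweighs L·2^d.
  above-gap : ∀ j e r → e ≡ suc (j + r) → copies₋₂ j * 2 ^ suc (2 * e) ℕ.< copies₁ j + 4 ^ suc (2 * e)
  above-gap j e r refl = begin-strict
    copies₋₂ j * 2 ^ d    ≡⟨ negative-part j d ⟩
    2 ^ (2 + 2 * j + d)   ≤⟨ ^-monoʳ-≤ 2 (m+n≤o⇒m≤o (2 + 2 * j + d) (≤-reflexive (exponents j r))) ⟩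
    2 ^ (2 * d)           ≡⟨ four^ d ⟨
    4 ^ d                 <⟨ m<n+m (4 ^ d) (m^n>0 2 (suc (4 * j))) ⟩
    copies₁ j + 4 ^ d     ∎
    where
    open ≤-Reasoning
    d = suc (2 * suc (j + r))
    exponents : ∀ j r → 2 + 2 * j + suc (2 * suc (j + r)) + suc (2 * r) ≡ 2 * suc (2 * suc (j + r))
    exponents = solve-∀

  -- At d = 2j+1 itself: N + 4^d = X + 2X < 4X = L·2^d, where X = 2^(4j+1).
  at-gap : ∀ j → copies₁ j + 4 ^ suc (2 * j) ℕ.< copies₋₂ j * 2 ^ suc (2 * j)
  at-gap j = begin-strict
    X + 4 ^ d               ≡⟨ cong (X +_) (trans (four^ d) (cong (2 ^_) (doubled j))) ⟩
    X + 2 * X               <⟨ m<m+n (X + 2 * X) (m^n>0 2 (suc (4 * j))) ⟩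
    X + 2 * X + X           ≡⟨ fourfold X ⟩
    2 * (2 * X)             ≡⟨ cong (2 ^_) (exponent j) ⟨
    2 ^ (2 + 2 * j + d)     ≡⟨ negative-part j d ⟨
    copies₋₂ j * 2 ^ d      ∎
    where
    open ≤-Reasoning
    d = suc (2 * j)
    X = copies₁ j
    doubled : ∀ j → 2 * suc (2 * j) ≡ suc (suc (4 * j))
    doubled = solve-∀
    exponent : ∀ j → 2 + 2 * j + suc (2 * j) ≡ suc (suc (suc (4 * j)))
    exponent = solve-∀
    fourfold : ∀ X → X + 2 * X + X ≡ 2 * (2 * X)
    fourfold = solve-∀

open PowerGaps using (copies₁; copies₋₂; below-gap; above-gap; at-gap)

-- The rationals as a commutative semiring; its sum and prod are sumℚ and prodℚ.
ℚ-semiring : CommutativeSemiring _ _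
ℚ-semiring = CommutativeRing.commutativeSemiring ℚ.+-*-commutativeRing

open BigOperators ℚ-semiring
open import Algebra.Definitions.RawSemiring (CommutativeSemiring.rawSemiring ℚ-semiring) using (_^_) renaming (_×_ to _times_)
open import Algebra.Properties.Semiring.Mult (CommutativeSemiring.semiring ℚ-semiring) using (×-homo-+; ×1-homo-*)
open import Algebra.Properties.Semiring.Exp (CommutativeSemiring.semiring ℚ-semiring) using (^-assocʳ)

adjacent-distinct : ∀ {n} (G : SimpleGraph n) {u v} → adj G u v ≡ true → u ≢ v
adjacent-distinct G {u} u~v ≡.refl with ≡.trans (≡.sym u~v) (loopless G u)
... | ()

upEdge : ∀ {n} → SimpleGraph n → Fin n → Fin n → Bool
upEdge G u v = adj G u v ∧ ⌊ toℕ u <? toℕ v ⌋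

upEdge-orients : ∀ {n} (G : SimpleGraph n) → Π.Orients (upEdge G) (adj G)
upEdge-orients G u v rewrite SimpleGraph.sym G v u with adj G u v in u~v
... | false = ≡.refl , ≡.refl
... | true with toℕ u <? toℕ v | toℕ v <? toℕ u
...   | yes u<v | yes v<u = ⊥-elim (ℕₚ.<-asym u<v v<u)
...   | yes _   | no _    = ≡.refl , ≡.refl
...   | no _    | yes _   = ≡.refl , ≡.refl
...   | no u≮v  | no v≮u  =
  ⊥-elim (adjacent-distinct G u~v (toℕ-injective (ℕₚ.≤-antisym (ℕₚ.≮⇒≥ v≮u) (ℕₚ.≮⇒≥ u≮v))))

selectedProduct : ∀ {n m} → (Fin n → Fin n → Bool) → WeightedGraph m → (Fin n → Fin m) → ℚ
selectedProduct {n} e H φ =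
  prodℚ (concatMap (λ u → map (λ v → if e u v then β H (φ u) (φ v) else 1ℚ) (allFin n)) (allFin n))

selectedProduct-cong : ∀ {n m} {e e′ : Fin n → Fin n → Bool} → (∀ u v → e u v ≡ e′ u v) →
                       (H : WeightedGraph m) (φ : Fin n → Fin m) → selectedProduct e H φ ≡ selectedProduct e′ H φ
selectedProduct-cong {n} e≡e′ H φ =
  ≡.cong prodℚ (concatMap-cong (λ u → map-cong (λ v → ≡.cong (λ b → if b then β H (φ u) (φ v) else 1ℚ) (e≡e′ u v))
                                                (allFin n))
                               (allFin n))

-- Its selector uses a Boolean
-- conjunction local to the definition of edgeProduct, so it cannot be named;
-- unification finds it, and case analysis on adjacency identifies it below.
edgeProduct-isSelected : ∀ {n m} (G : SimpleGraph n) (H : WeightedGraph m) (φ : Fin n → Fin m) →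
                         ∃ λ (e : Fin n → Fin n → Bool) → edgeProduct G H φ ≡ selectedProduct e H φ
edgeProduct-isSelected G H φ = _ , ≡.refl

edgeProduct-selector : ∀ {n m} (G : SimpleGraph n) (H : WeightedGraph m) (φ : Fin n → Fin m) u v →
                       proj₁ (edgeProduct-isSelected G H φ) u v ≡ upEdge G u v
edgeProduct-selector G H φ u v with adj G u v
... | true  = ≡.refl
... | false = ≡.refl

edgeProduct-upEdges : ∀ {n m} (G : SimpleGraph n) (H : WeightedGraph m) (φ : Fin n → Fin m) →
                      edgeProduct G H φ ≡ selectedProduct (upEdge G) H φ
edgeProduct-upEdges G H φ =
  ≡.trans (proj₂ (edgeProduct-isSelected G H φ)) (selectedProduct-cong (edgeProduct-selector G H φ) H φ)

rankOne : ∀ {m} → (Fin m → ℚ) → WeightedGraph m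
rankOne w = record { β = λ i j → w i *ℚ w j ; β-sym = λ i j → ℚ.*-comm (w i) (w j) }

-- For rank-one weights each vertex u contributes w(φ u) once per incident edge.
edgeProduct-rankOne : ∀ {n m} (G : SimpleGraph n) (w : Fin m → ℚ) (φ : Fin n → Fin m) →
                      edgeProduct G (rankOne w) φ ≡ prodℚ (map (λ u → w (φ u) ^ degree G u) (allFin n))
edgeProduct-rankOne {n} G w φ =
  ≡.trans (edgeProduct-upEdges G (rankOne w) φ) (Π.fold-oriented-pairs (upEdge-orients G) (w ∘ φ) (allFin n))

powerSum : ∀ {m} → (Fin m → ℚ) → ℕ → ℚ
powerSum {m} w d = sumℚ (map (λ i → w i ^ d) (allFin m))

hom-rankOne : ∀ {n m} (G : SimpleGraph n) (w : Fin m → ℚ) →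
              hom G (rankOne w) ≡ prodℚ (map (λ u → powerSum w (degree G u)) (allFin n))
hom-rankOne {n} {m} G w =
  ≡.trans (≡.cong sumℚ (map-cong (edgeProduct-rankOne G w) (allMaps n m)))
          (sum-of-products n m (λ u i → w i ^ degree G u))

suc-odd : ∀ j → suc (suc (2 ℕ.* j)) ≡ 2 ℕ.* suc j
suc-odd j = ≡.cong suc (≡.sym (ℕₚ.+-suc j (j ℕ.+ 0)))

odd-injective : ∀ {e j} → suc (2 ℕ.* e) ≡ suc (2 ℕ.* j) → e ≡ j
odd-injective {e} {j} eq = ℕₚ.*-cancelˡ-≡ e j 2 (ℕₚ.suc-injective eq)

parity : ∀ d → Even d ⊎ Odd d
parity zero    = inj₁ (0 , ≡.refl)
parity (suc d) with parity d
... | inj₁ (e , ≡.refl) = inj₂ (e , ≡.refl)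
... | inj₂ (e , ≡.refl) = inj₁ (suc e , suc-odd e)

neg*pos : ∀ {p q} → p < 0ℚ → 0ℚ < q → p *ℚ q < 0ℚ
neg*pos {p} {q} p<0 0<q = ℚ.negative⁻¹ _ {{ℚ.neg*pos⇒neg p {{negative p<0}} q {{positive 0<q}}}}

neg*neg : ∀ {p q} → p < 0ℚ → q < 0ℚ → 0ℚ < p *ℚ q
neg*neg {p} {q} p<0 q<0 = ℚ.positive⁻¹ _ {{ℚ.neg*neg⇒pos p {{negative p<0}} q {{negative q<0}}}}

pos*pos : ∀ {p q} → 0ℚ < p → 0ℚ < q → 0ℚ < p *ℚ q
pos*pos {p} {q} 0<p 0<q = ℚ.positive⁻¹ _ {{ℚ.pos*pos⇒pos p {{positive 0<p}} q {{positive 0<q}}}}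

pos*neg : ∀ {p q} → 0ℚ < p → q < 0ℚ → p *ℚ q < 0ℚ
pos*neg {p} {q} 0<p q<0 = ℚ.negative⁻¹ _ {{ℚ.pos*neg⇒neg p {{positive 0<p}} q {{negative q<0}}}}

product-sign : ∀ {a p} {A : Set a} {P : A → Set p} (P? : Decidable P) (g : A → ℚ) →
  (∀ x → P x → g x < 0ℚ) → (∀ x → ¬ P x → 0ℚ < g x) → ∀ xs →
  (0ℚ < prodℚ (map g xs) × Even (length (filter P? xs))) ⊎ (prodℚ (map g xs) < 0ℚ × Odd (length (filter P? xs)))
product-sign P? g neg pos [] = inj₁ (ℚ.positive⁻¹ 1ℚ , 0 , ≡.refl)
product-sign P? g neg pos (x ∷ xs) with P? x | product-sign P? g neg pos xs
... | yes Px | inj₁ (0<Π , j , even) = inj₂ (neg*pos (neg x Px) 0<Π , j , ≡.cong suc even)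
... | yes Px | inj₂ (Π<0 , j , odd)  = inj₁ (neg*neg (neg x Px) Π<0 , suc j , ≡.trans (≡.cong suc odd) (suc-odd j))
... | no ¬Px | inj₁ (0<Π , even)     = inj₁ (pos*pos (pos x ¬Px) 0<Π , even)
... | no ¬Px | inj₂ (Π<0 , odd)      = inj₂ (pos*neg (pos x ¬Px) Π<0 , odd)

nonnegative-product-even : ∀ {a p} {A : Set a} {P : A → Set p} (P? : Decidable P) (g : A → ℚ) →
  (∀ x → P x → g x < 0ℚ) → (∀ x → ¬ P x → 0ℚ < g x) → ∀ xs →
  0ℚ ≤ prodℚ (map g xs) → Even (length (filter P? xs))
nonnegative-product-even P? g neg pos xs 0≤Π with product-sign P? g neg pos xs
... | inj₁ (_ , even) = even
... | inj₂ (Π<0 , _)  = ⊥-elim (ℚ.<-irrefl ≡.refl (ℚ.≤-<-trans 0≤Π Π<0))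

Detects : ∀ {m} → (Fin m → ℚ) → ℕ → Set
Detects w k = ∀ d → (d ≡ k → powerSum w d < 0ℚ) × (d ≢ k → 0ℚ < powerSum w d)

positive-even-count : ∀ {n m} (G : SimpleGraph n) → Positive G → (w : Fin m → ℚ) (k : ℕ) →
                      Detects w k → Even (countDegree G k)
positive-even-count {n} {m} G G-positive w k detects =
  nonnegative-product-even (λ u → degree G u ℕ.≟ k) (λ u → powerSum w (degree G u))
    (λ u → proj₁ (detects (degree G u))) (λ u → proj₂ (detects (degree G u))) (allFin n)
    (≡.subst (0ℚ ≤_) (hom-rankOne G w) (G-positive m (rankOne w)))

ι : ℕ → ℚ
ι n = n times 1ℚ

ι-+ : ∀ a b → ι (a ℕ.+ b) ≡ ι a +ℚ ι b
ι-+ a b = ×-homo-+ 1ℚ a b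

ι-* : ∀ a b → ι (a ℕ.* b) ≡ ι a *ℚ ι b
ι-* = ×1-homo-*

ι-^ : ∀ a d → ι (a ℕ.^ d) ≡ ι a ^ d
ι-^ a zero    = ℚ.+-identityʳ 1ℚ
ι-^ a (suc d) = ≡.trans (ι-* a (a ℕ.^ d)) (≡.cong (ι a *ℚ_) (ι-^ a d))

ι-nonneg : ∀ n → 0ℚ ≤ ι n
ι-nonneg zero    = ℚ.≤-refl
ι-nonneg (suc n) = ℚ.+-mono-≤ (ℚ.<⇒≤ (ℚ.positive⁻¹ 1ℚ)) (ι-nonneg n)

ι-pos : ∀ n → 0ℚ < ι (suc n)
ι-pos n = ℚ.+-mono-<-≤ (ℚ.positive⁻¹ 1ℚ) (ι-nonneg n)

ι-positive : ∀ {n} → 0 ℕ.< n → 0ℚ < ι n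
ι-positive {suc n} _ = ι-pos n

ι-difference : ∀ a b → ι (a ℕ.+ b) - ι a ≡ ι b
ι-difference a b = ≡.trans (≡.cong (_- ι a) (ι-+ a b)) (cancel (ι a) (ι b))
  where
  open +-*-Solver
  cancel : ∀ x y → (x +ℚ y) - x ≡ y
  cancel = solve 2 (λ x y → (x :+ y) :- x := y) ≡.refl

ι-difference-pos : ∀ {a b} → b ℕ.< a → 0ℚ < ι a - ι b
ι-difference-pos {b = b} b<a with ℕₚ.m≤n⇒∃[o]m+o≡n b<a
... | o , ≡.refl = ≡.subst (0ℚ <_) (≡.sym difference) (ι-pos o)
  where
  difference : ι (suc b ℕ.+ o) - ι b ≡ ι (suc o)
  difference = ≡.trans (≡.cong (λ t → ι t - ι b) (≡.sym (ℕₚ.+-suc b o))) (ι-difference b (suc o))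

ι-difference-neg : ∀ {a b} → a ℕ.< b → ι a - ι b < 0ℚ
ι-difference-neg {a} {b} a<b = ≡.subst (_< 0ℚ) (swap (ι b) (ι a)) (ℚ.neg-antimono-< (ι-difference-pos a<b))
  where
  open +-*-Solver
  swap : ∀ x y → - (x - y) ≡ y - x
  swap = solve 2 (λ x y → :- (x :- y) := y :- x) ≡.refl

neg-^-even : ∀ x e → (- x) ^ (2 ℕ.* e) ≡ x ^ (2 ℕ.* e)
neg-^-even x e = begin
  (- x) ^ (2 ℕ.* e)   ≡⟨ ^-assocʳ (- x) 2 e ⟨
  ((- x) ^ 2) ^ e     ≡⟨ ≡.cong (_^ e) (square x) ⟩
  (x ^ 2) ^ e         ≡⟨ ^-assocʳ x 2 e ⟩
  x ^ (2 ℕ.* e)       ∎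
  where
  open ≡.≡-Reasoning
  open +-*-Solver
  square : ∀ x → (- x) ^ 2 ≡ x ^ 2
  square = solve 1 (λ x → (:- x) :* ((:- x) :* con 1ℚ) := x :* (x :* con 1ℚ)) ≡.refl

neg-^-odd : ∀ x e → (- x) ^ suc (2 ℕ.* e) ≡ - (x ^ suc (2 ℕ.* e))
neg-^-odd x e = ≡.trans (≡.cong (- x *ℚ_) (neg-^-even x e)) (≡.sym (ℚ.neg-distribˡ-* x (x ^ (2 ℕ.* e))))

sum-replicate : ∀ (f : ℚ → ℚ) c y → sumℚ (map f (replicate c y)) ≡ ι c *ℚ f y
sum-replicate f zero    y = ≡.sym (ℚ.*-zeroˡ (f y))
sum-replicate f (suc c) y = ≡.trans (≡.cong (f y +ℚ_) (sum-replicate f c y)) (collect (f y) (ι c))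
  where
  open +-*-Solver
  collect : ∀ x n → x +ℚ n *ℚ x ≡ (1ℚ +ℚ n) *ℚ x
  collect = solve 2 (λ x n → x :+ n :* x := (con 1ℚ :+ n) :* x) ≡.refl

sum-++ : ∀ {a} {A : Set a} (f : A → ℚ) xs ys → sumℚ (map f (xs ++ ys)) ≡ sumℚ (map f xs) +ℚ sumℚ (map f ys)
sum-++ f xs ys = ≡.trans (≡.cong sumℚ (map-++ f xs ys)) (Σ.fold-++ (map f xs) (map f ys))

listPowerSum : List ℚ → ℕ → ℚ
listPowerSum ws d = sumℚ (map (_^ d) ws)

powerSum-lookup : ∀ ws d → powerSum (lookup ws) d ≡ listPowerSum ws d
powerSum-lookup ws d = ≡.cong sumℚ (begin
  map (λ i → lookup ws i ^ d) (tabulate (λ i → i)) ≡⟨ map-tabulate (λ i → i) (λ i → lookup ws i ^ d) ⟩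
  tabulate (λ i → lookup ws i ^ d)                 ≡⟨ map-tabulate (lookup ws) (_^ d) ⟨
  map (_^ d) (tabulate (lookup ws))                ≡⟨ ≡.cong (map (_^ d)) (tabulate-lookup ws) ⟩
  map (_^ d) ws                                    ∎)
  where open ≡.≡-Reasoning

detectingWeights : ℕ → List ℚ
detectingWeights j = replicate (copies₁ j) (ι 1) ++ replicate (copies₋₂ j) (- ι 2) ++ ι 4 ∷ []

detectingWeights-powerSum : ∀ j d →
  listPowerSum (detectingWeights j) d ≡ ι (copies₁ j) +ℚ (ι (copies₋₂ j) *ℚ (- ι 2) ^ d +ℚ ι (4 ℕ.^ d))
detectingWeights-powerSum j d = begin
  sumℚ (map f (ones ++ minusTwos ++ ι 4 ∷ []))
    ≡⟨ sum-++ f ones (minusTwos ++ ι 4 ∷ []) ⟩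
  sumℚ (map f ones) +ℚ sumℚ (map f (minusTwos ++ ι 4 ∷ []))
    ≡⟨ ≡.cong (sumℚ (map f ones) +ℚ_) (sum-++ f minusTwos (ι 4 ∷ [])) ⟩
  sumℚ (map f ones) +ℚ (sumℚ (map f minusTwos) +ℚ (ι 4 ^ d +ℚ 0ℚ))
    ≡⟨ ≡.cong₂ (λ a b → a +ℚ (b +ℚ (ι 4 ^ d +ℚ 0ℚ)))
               (sum-replicate f (copies₁ j) (ι 1)) (sum-replicate f (copies₋₂ j) (- ι 2)) ⟩
  ι (copies₁ j) *ℚ ι 1 ^ d +ℚ (ι (copies₋₂ j) *ℚ (- ι 2) ^ d +ℚ (ι 4 ^ d +ℚ 0ℚ))
    ≡⟨ ≡.cong₂ (λ a b → a +ℚ (ι (copies₋₂ j) *ℚ (- ι 2) ^ d +ℚ b))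
               ones-contribute (≡.trans (ℚ.+-identityʳ _) (≡.sym (ι-^ 4 d))) ⟩
  ι (copies₁ j) +ℚ (ι (copies₋₂ j) *ℚ (- ι 2) ^ d +ℚ ι (4 ℕ.^ d)) ∎
  where
  open ≡.≡-Reasoning
  f : ℚ → ℚ
  f = _^ d
  ones minusTwos : List ℚ
  ones = replicate (copies₁ j) (ι 1)
  minusTwos = replicate (copies₋₂ j) (- ι 2)
  ones-contribute : ι (copies₁ j) *ℚ ι 1 ^ d ≡ ι (copies₁ j)
  ones-contribute = ≡.trans (≡.cong (ι (copies₁ j) *ℚ_) (≡.trans (≡.sym (ι-^ 1 d)) (≡.cong ι (ℕₚ.^-zeroˡ d))))
                          (ℚ.*-identityʳ (ι (copies₁ j)))

even-powerSum : ∀ j e → listPowerSum (detectingWeights j) (2 ℕ.* e)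
                         ≡ ι (copies₁ j ℕ.+ (copies₋₂ j ℕ.* 2 ℕ.^ (2 ℕ.* e) ℕ.+ 4 ℕ.^ (2 ℕ.* e)))
even-powerSum j e = begin
  listPowerSum (detectingWeights j) d
    ≡⟨ detectingWeights-powerSum j d ⟩
  ι N +ℚ (ι L *ℚ (- ι 2) ^ d +ℚ ι (4 ℕ.^ d))
    ≡⟨ ≡.cong (λ t → ι N +ℚ (ι L *ℚ t +ℚ ι (4 ℕ.^ d))) (≡.trans (neg-^-even (ι 2) e) (≡.sym (ι-^ 2 d))) ⟩
  ι N +ℚ (ι L *ℚ ι (2 ℕ.^ d) +ℚ ι (4 ℕ.^ d))
    ≡⟨ ≡.cong (λ t → ι N +ℚ (t +ℚ ι (4 ℕ.^ d))) (≡.sym (ι-* L (2 ℕ.^ d))) ⟩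
  ι N +ℚ (ι (L ℕ.* 2 ℕ.^ d) +ℚ ι (4 ℕ.^ d))
    ≡⟨ ≡.cong (ι N +ℚ_) (≡.sym (ι-+ (L ℕ.* 2 ℕ.^ d) (4 ℕ.^ d))) ⟩
  ι N +ℚ ι (L ℕ.* 2 ℕ.^ d ℕ.+ 4 ℕ.^ d)
    ≡⟨ ≡.sym (ι-+ N _) ⟩
  ι (N ℕ.+ (L ℕ.* 2 ℕ.^ d ℕ.+ 4 ℕ.^ d)) ∎
  where
  open ≡.≡-Reasoning
  d = 2 ℕ.* e
  N = copies₁ j
  L = copies₋₂ j

odd-powerSum : ∀ j e → listPowerSum (detectingWeights j) (suc (2 ℕ.* e))
                        ≡ ι (copies₁ j ℕ.+ 4 ℕ.^ suc (2 ℕ.* e)) - ι (copies₋₂ j ℕ.* 2 ℕ.^ suc (2 ℕ.* e))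
odd-powerSum j e = begin
  listPowerSum (detectingWeights j) d
    ≡⟨ detectingWeights-powerSum j d ⟩
  ι N +ℚ (ι L *ℚ (- ι 2) ^ d +ℚ ι (4 ℕ.^ d))
    ≡⟨ ≡.cong (λ t → ι N +ℚ (ι L *ℚ t +ℚ ι (4 ℕ.^ d)))
              (≡.trans (neg-^-odd (ι 2) e) (≡.cong -_ (≡.sym (ι-^ 2 d)))) ⟩
  ι N +ℚ (ι L *ℚ (- ι (2 ℕ.^ d)) +ℚ ι (4 ℕ.^ d))
    ≡⟨ regroup (ι N) (ι L) (ι (2 ℕ.^ d)) (ι (4 ℕ.^ d)) ⟩
  (ι N +ℚ ι (4 ℕ.^ d)) - ι L *ℚ ι (2 ℕ.^ d)
    ≡⟨ ≡.cong₂ _-_ (≡.sym (ι-+ N (4 ℕ.^ d))) (≡.sym (ι-* L (2 ℕ.^ d))) ⟩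
  ι (N ℕ.+ 4 ℕ.^ d) - ι (L ℕ.* 2 ℕ.^ d) ∎
  where
  open ≡.≡-Reasoning
  open +-*-Solver
  d = suc (2 ℕ.* e)
  N = copies₁ j
  L = copies₋₂ j
  regroup : ∀ a b x y → a +ℚ (b *ℚ (- x) +ℚ y) ≡ (a +ℚ y) - b *ℚ x
  regroup = solve 4 (λ a b x y → a :+ (b :* (:- x) :+ y) := (a :+ y) :- b :* x) ≡.refl

odd-powerSum-sign : ∀ j e → (e ≡ j → listPowerSum (detectingWeights j) (suc (2 ℕ.* e)) < 0ℚ)
                          × (e ≢ j → 0ℚ < listPowerSum (detectingWeights j) (suc (2 ℕ.* e)))
odd-powerSum-sign j e = at , elsewhere
  where
  at : e ≡ j → listPowerSum (detectingWeights j) (suc (2 ℕ.* e)) < 0ℚ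
  at ≡.refl = ≡.subst (_< 0ℚ) (≡.sym (odd-powerSum j j)) (ι-difference-neg (at-gap j))
  from-gap : copies₋₂ j ℕ.* 2 ℕ.^ suc (2 ℕ.* e) ℕ.< copies₁ j ℕ.+ 4 ℕ.^ suc (2 ℕ.* e) →
             0ℚ < listPowerSum (detectingWeights j) (suc (2 ℕ.* e))
  from-gap gap = ≡.subst (0ℚ <_) (≡.sym (odd-powerSum j e)) (ι-difference-pos gap)
  elsewhere : e ≢ j → 0ℚ < listPowerSum (detectingWeights j) (suc (2 ℕ.* e))
  elsewhere e≢j with ℕₚ.<-cmp e j
  ... | tri< e<j _ _ = let r , eq = ℕₚ.m≤n⇒∃[o]m+o≡n e<j in from-gap (below-gap j e r (≡.sym eq))
  ... | tri≈ _ e≡j _ = ⊥-elim (e≢j e≡j)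
  ... | tri> _ _ j<e = let r , eq = ℕₚ.m≤n⇒∃[o]m+o≡n j<e in from-gap (above-gap j e r (≡.sym eq))

detectingWeights-sign : ∀ j d → (d ≡ suc (2 ℕ.* j) → listPowerSum (detectingWeights j) d < 0ℚ)
                              × (d ≢ suc (2 ℕ.* j) → 0ℚ < listPowerSum (detectingWeights j) d)
detectingWeights-sign j d with parity d
... | inj₁ (e , ≡.refl) = (λ even≡odd → ⊥-elim (ℕₚ.even≢odd e j even≡odd))
                        , (λ _ → ≡.subst (0ℚ <_) (≡.sym (even-powerSum j e))
                                   (ι-positive (ℕₚ.<-≤-trans (ℕₚ.m^n>0 2 (suc (4 ℕ.* j))) (ℕₚ.m≤m+n _ _))))
... | inj₂ (e , ≡.refl) = (λ d≡k → proj₁ (odd-powerSum-sign j e) (odd-injective d≡k))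
                        , (λ d≢k → proj₂ (odd-powerSum-sign j e) (d≢k ∘ ≡.cong (λ i → suc (2 ℕ.* i))))

detecting : ∀ j → Detects (lookup (detectingWeights j)) (suc (2 ℕ.* j))
detecting j d = ≡.subst (λ p → (d ≡ suc (2 ℕ.* j) → p < 0ℚ) × (d ≢ suc (2 ℕ.* j) → 0ℚ < p))
                        (≡.sym (powerSum-lookup (detectingWeights j) d)) (detectingWeights-sign j d)

mainTheorem15 : (n : ℕ) (G : SimpleGraph n) → Positive G →
                  (k : ℕ) → Odd k → Even (countDegree G k)
mainTheorem15 n G G-positive .(suc (2 ℕ.* j)) (j , ≡.refl) =
  positive-even-count G G-positive (lookup (detectingWeights j)) (suc (2 ℕ.* j)) (detecting j)
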